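{- Let $k_A, k_B, \Delta_A, \Delta_B$ be positive integers. The complete bipartite graph $K_{\Delta_B,\Delta_A}$ fails to be $(k_A,k_B)$-choosable if and only if there exist a $k_A$-uniform hypergraph $H$ with exactly $\Delta_B$ (distinct) edges and a family $\mathcal{F}$ of $\Delta_A$ distinct $k_B$-element subsets of the vertex set of $H$ such that every independent set of $H$ is disjoint from some element of $\mathcal{F}$.
   Context: All graphs are finite and simple. For a bipartite graph $G$ with bipartition $V = A \sqcup B$ and positive integers $k_A, k_B$, $G$ is $(k_A,k_B)$-choosable if for every set of colors $C$ and every list assignment $L$ assigning to each vertex of $A$ a $k_A$-element subset of $C$ and to each vertex of $B$ a $k_B$-element subset of $C$, there is a map $c\colon V\to C$ with $c(v)\in L(v)$ for all $v$ and $c(v)\neq c(v')$ for every edge $vv'$. For the complete bipartite graph $K_{\Delta_B,\Delta_A}$ the part $A$ has $\Delta_B$ vertices and the part $B$ has $\Delta_A$ vertices. An independent set of a hypergraph is a set of vertices containing no edge. -}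

module Defs where

open import Data.Nat using (ℕ)
open import Data.Fin using (Fin)
open import Data.Fin.Subset using (Subset; _∈_; _∉_; _⊆_; ∣_∣)
open import Data.Product using (Σ; ∃; _×_)
open import Data.Unit using (⊤)
open import Relation.Nullary using (¬_)
open import Relation.Binary.PropositionalEquality using (_≡_; _≢_)
open import Function.Definitions using (Injective)

BipAdj : ℕ → ℕ → Set₁
BipAdj p q = Fin p → Fin q → Set

-- Complete bipartite graph K_{ΔB,ΔA}: part A has ΔB vertices, part B has ΔA vertices.
completeBip : (ΔB ΔA : ℕ) → BipAdj ΔB ΔA
completeBip ΔB ΔA _ _ = ⊤

-- (kA,kB)-choosability. Colour set: an arbitrary finite set Fin m (m arbitrary);
-- lists are subsets of the colour set of the prescribed sizes.
Choosable : {p q : ℕ} → BipAdj p q → (kA kB : ℕ) → Set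
Choosable {p} {q} adj kA kB =
  (m : ℕ) (LA : Fin p → Subset m) (LB : Fin q → Subset m) →
  (∀ a → ∣ LA a ∣ ≡ kA) → (∀ b → ∣ LB b ∣ ≡ kB) →
  Σ (Fin p → Fin m) λ cA → Σ (Fin q → Fin m) λ cB →
    (∀ a → cA a ∈ LA a) × (∀ b → cB b ∈ LB b) ×
    (∀ a b → adj a b → cA a ≢ cB b)

UniformWithEdges : {n : ℕ} (k e : ℕ) → (Fin e → Subset n) → Set
UniformWithEdges k e E = Injective _≡_ _≡_ E × (∀ i → ∣ E i ∣ ≡ k)

Independent : {n e : ℕ} → (Fin e → Subset n) → Subset n → Set
Independent E I = ∀ i → ¬ (E i ⊆ I)

Disjoint : {n : ℕ} → Subset n → Subset n → Set
Disjoint X Y = ∀ x → x ∈ X → x ∉ Y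

-- A list assignment of the complete bipartite graph is colourable iff some set I
-- of colours (the colours used on B) contains no A-list and meets every B-list.
-- Read the A-lists as the edges of a hypergraph H and the B-lists as the family F:
-- the assignment is uncolourable exactly when every independent set of H misses
-- some member of F. It remains to turn an arbitrary uncolourable assignment into
-- one with pairwise distinct lists on each side. Colours lying in no list can be
-- deleted, so choosability only has to be checked with ΔB kA + ΔA kB colours,
-- where it is decidable and a bad assignment can be found by search. A repeated
-- list can be replaced by a block of fresh colours, since vertices with equal
-- lists may share a colour.
module Submission where

open import Defs
open import Data.Bool.Properties using () renaming (_≟_ to _≟ᵇ_)
open import Data.Fin using (Fin; zero; suc; _↑ˡ_; _↑ʳ_; punchIn)
open import Data.Fin.Properties using (any?; all?; ¬∀⟶∃¬; punchIn-injective) renaming (_≟_ to _≟ᶠ_)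
open import Data.Fin.Subset using (Subset; inside; outside; _∈_; _∉_; _⊆_; _⊈_; ∣_∣; ⊥; ⊤; ⁅_⁆; _∪_; ⋃)
open import Data.Fin.Subset.Properties
  using (_∈?_; _⊆?_; ∉⊥; ∣⊥∣≡0; ∣⊤∣≡n; ∣⁅x⁆∣≡1; x∈⁅x⁆; x∈⁅y⁆⇒x≡y; x∈p∪q⁺; x∈p∪q⁻; p⊆q⇒∣p∣≤∣q∣; anySubset?)
import Data.List as List
open import Data.Nat using (ℕ; zero; suc; _+_; _*_; _≤_; _<_; _≥_; z≤n; s≤s)
open import Data.Nat.Properties
  using (≤-reflexive; ≤-trans; ≤-total; +-mono-≤; +-monoʳ-≤; +-suc; +-comm; +-identityʳ; n≤1+n; m≤n+m; <⇒≱; m≤n⇒∃[o]m+o≡n)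
  renaming (_≟_ to _≟ℕ_)
open import Data.Product using (Σ; Σ-syntax; ∃; _×_; _,_; proj₁; proj₂)
import Data.Product as Product
open import Data.Sum using (_⊎_; inj₁; inj₂; [_,_])
import Data.Sum as Sum
open import Data.Vec using (_∷_; []; _++_; removeAt; here; there)
open import Data.Vec.Properties using (≡-dec; ++-injectiveˡ; ++-injectiveʳ)
open import Data.Vec.Functional using () renaming (_∷_ to _◃_)
open import Function using (_∘_; id)
open import Function.Definitions using (Injective)
open import Function.Bundles using (_⇔_; mk⇔; Equivalence)
open import Level using (0ℓ)
open import Relation.Binary.Definitions using (DecidableEquality; _Respects_)
open import Relation.Binary.PropositionalEquality using (_≡_; _≢_; _≗_; refl; sym; trans; cong; cong₂; subst; module ≡-Reasoning)
open import Relation.Nullary using (¬_; Dec; yes; no; contradiction)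
open import Relation.Nullary.Decidable using (map′; ¬?; _×-dec_; _→-dec_; decidable-stable)
open import Relation.Unary using (Pred; Decidable)

variable
  k kA kB m n p q r : ℕ

∣p∪q∣≤∣p∣+∣q∣ : (s t : Subset n) → ∣ s ∪ t ∣ ≤ ∣ s ∣ + ∣ t ∣
∣p∪q∣≤∣p∣+∣q∣ [] [] = z≤n
∣p∪q∣≤∣p∣+∣q∣ (inside ∷ s) (inside ∷ t) = s≤s (≤-trans (∣p∪q∣≤∣p∣+∣q∣ s t) (+-monoʳ-≤ ∣ s ∣ (n≤1+n ∣ t ∣)))
∣p∪q∣≤∣p∣+∣q∣ (inside ∷ s) (outside ∷ t) = s≤s (∣p∪q∣≤∣p∣+∣q∣ s t)
∣p∪q∣≤∣p∣+∣q∣ (outside ∷ s) (inside ∷ t) =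
  subst (suc ∣ s ∪ t ∣ ≤_) (sym (+-suc ∣ s ∣ ∣ t ∣)) (s≤s (∣p∪q∣≤∣p∣+∣q∣ s t))
∣p∪q∣≤∣p∣+∣q∣ (outside ∷ s) (outside ∷ t) = ∣p∪q∣≤∣p∣+∣q∣ s t

∣p++q∣≡∣p∣+∣q∣ : (s : Subset m) (t : Subset n) → ∣ s ++ t ∣ ≡ ∣ s ∣ + ∣ t ∣
∣p++q∣≡∣p∣+∣q∣ [] t = refl
∣p++q∣≡∣p∣+∣q∣ (inside ∷ s) t = cong suc (∣p++q∣≡∣p∣+∣q∣ s t)
∣p++q∣≡∣p∣+∣q∣ (outside ∷ s) t = ∣p++q∣≡∣p∣+∣q∣ s t

∣p++⊥∣≡∣p∣ : (s : Subset m) → ∣ s ++ ⊥ {n} ∣ ≡ ∣ s ∣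
∣p++⊥∣≡∣p∣ {n = n} s = trans (∣p++q∣≡∣p∣+∣q∣ s ⊥) (trans (cong (∣ s ∣ +_) (∣⊥∣≡0 n)) (+-identityʳ ∣ s ∣))

x∈p⇒x↑ˡ∈p++q : {s : Subset m} (t : Subset n) {x : Fin m} → x ∈ s → x ↑ˡ n ∈ s ++ t
x∈p⇒x↑ˡ∈p++q t here = here
x∈p⇒x↑ˡ∈p++q t (there x∈s) = there (x∈p⇒x↑ˡ∈p++q t x∈s)

x∈p++q⁻ : (s : Subset m) {t : Subset n} {x : Fin (m + n)} → x ∈ s ++ t →
  (∃ λ y → x ≡ y ↑ˡ n × y ∈ s) ⊎ (∃ λ z → x ≡ m ↑ʳ z × z ∈ t)
x∈p++q⁻ [] x∈t = inj₂ (_ , refl , x∈t)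
x∈p++q⁻ (inside ∷ s) here = inj₁ (zero , refl , here)
x∈p++q⁻ (_ ∷ s) (there x∈) =
  Sum.map (Product.map suc (Product.map (cong suc) there)) (Product.map₂ (Product.map₁ (cong suc))) (x∈p++q⁻ s x∈)

x∈p++⊥⁻ : (s : Subset m) {x : Fin (m + n)} → x ∈ s ++ ⊥ → ∃ λ y → x ≡ y ↑ˡ n × y ∈ s
x∈p++⊥⁻ s x∈ = [ id , (λ (_ , _ , z∈⊥) → contradiction z∈⊥ ∉⊥) ] (x∈p++q⁻ s x∈)

x∈removeAt⁻ : (s : Subset (suc n)) (c : Fin (suc n)) {x : Fin n} → x ∈ removeAt s c → punchIn c x ∈ s
x∈removeAt⁻ (_ ∷ s) zero x∈ = there x∈
x∈removeAt⁻ (_ ∷ _ ∷ s) (suc c) here = here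
x∈removeAt⁻ (_ ∷ t ∷ s) (suc c) (there x∈) = there (x∈removeAt⁻ (t ∷ s) c x∈)

∣removeAt∣≡ : (s : Subset (suc n)) {c : Fin (suc n)} → c ∉ s → ∣ removeAt s c ∣ ≡ ∣ s ∣
∣removeAt∣≡ (inside ∷ s) {zero} c∉s = contradiction here c∉s
∣removeAt∣≡ (outside ∷ s) {zero} c∉s = refl
∣removeAt∣≡ (inside ∷ t ∷ s) {suc c} c∉s = cong suc (∣removeAt∣≡ (t ∷ s) (c∉s ∘ there))
∣removeAt∣≡ (outside ∷ t ∷ s) {suc c} c∉s = ∣removeAt∣≡ (t ∷ s) (c∉s ∘ there)

∣p∣<n⇒∃∉ : (s : Subset n) → ∣ s ∣ < n → ∃ λ x → x ∉ s
∣p∣<n⇒∃∉ {n} s ∣s∣<n = ¬∀⟶∃¬ n (_∈ s) (_∈? s) λ all∈ →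
  <⇒≱ ∣s∣<n (subst (_≤ ∣ s ∣) (∣⊤∣≡n n) (p⊆q⇒∣p∣≤∣q∣ {p = ⊤} λ {x} _ → all∈ x))

⊈⇒∃∉ : {s t : Subset n} → s ⊈ t → ∃ λ x → x ∈ s × x ∉ t
⊈⇒∃∉ {s = s} {t} s⊈t with any? (λ x → x ∈? s ×-dec ¬? (x ∈? t))
... | yes found = found
... | no ∄ = contradiction (λ {x} x∈s → decidable-stable (x ∈? t) (λ x∉t → ∄ (x , x∈s , x∉t))) s⊈t

¬Disjoint⇒∃∈ : {s t : Subset n} → ¬ Disjoint s t → ∃ λ x → x ∈ s × x ∈ t
¬Disjoint⇒∃∈ {s = s} {t} ¬disjoint with any? (λ x → x ∈? s ×-dec x ∈? t)
... | yes found = found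
... | no ∄ = contradiction (λ x x∈s x∈t → ∄ (x , x∈s , x∈t)) ¬disjoint

disjoint? : (s t : Subset n) → Dec (Disjoint s t)
disjoint? s t = all? λ x → x ∈? s →-dec ¬? (x ∈? t)

⊆-⋃-tabulate : (L : Fin n → Subset m) (i : Fin n) → L i ⊆ ⋃ (List.tabulate L)
⊆-⋃-tabulate L zero x∈ = x∈p∪q⁺ (inj₁ x∈)
⊆-⋃-tabulate L (suc i) x∈ = x∈p∪q⁺ (inj₂ (⊆-⋃-tabulate (L ∘ suc) i x∈))

∈-⋃-tabulate⁻ : (L : Fin n → Subset m) {x : Fin m} → x ∈ ⋃ (List.tabulate L) → ∃ λ i → x ∈ L i
∈-⋃-tabulate⁻ {n = zero} L x∈ = contradiction x∈ ∉⊥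
∈-⋃-tabulate⁻ {n = suc n} L x∈ =
  [ (zero ,_) , Product.map suc id ∘ ∈-⋃-tabulate⁻ (L ∘ suc) ] (x∈p∪q⁻ (L zero) _ x∈)

∣⋃-tabulate∣≤ : (L : Fin n → Subset m) → (∀ i → ∣ L i ∣ ≤ k) → ∣ ⋃ (List.tabulate L) ∣ ≤ n * k
∣⋃-tabulate∣≤ {n = zero} {m} L _ = ≤-reflexive (∣⊥∣≡0 m)
∣⋃-tabulate∣≤ {n = suc n} L ∣L∣≤k =
  ≤-trans (∣p∪q∣≤∣p∣+∣q∣ (L zero) _) (+-mono-≤ (∣L∣≤k zero) (∣⋃-tabulate∣≤ (L ∘ suc) (∣L∣≤k ∘ suc)))

record ListColouring {p q m : ℕ} (LA : Fin p → Subset m) (LB : Fin q → Subset m) : Set where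
  constructor colouring
  field
    colourA : Fin p → Fin m
    colourB : Fin q → Fin m
    colourA∈ : ∀ a → colourA a ∈ LA a
    colourB∈ : ∀ b → colourB b ∈ LB b
    proper : ∀ a b → colourA a ≢ colourB b

module _ {LA : Fin p → Subset m} {LB : Fin q → Subset m} where

  ListColouring-swap : ListColouring LA LB → ListColouring LB LA
  ListColouring-swap (colouring cA cB cA∈ cB∈ proper) = colouring cB cA cB∈ cA∈ λ b a → proper a b ∘ sym

  ListColouring-resp : {LA′ : Fin p → Subset m} {LB′ : Fin q → Subset m} →
    LA ≗ LA′ → LB ≗ LB′ → ListColouring LA LB → ListColouring LA′ LB′
  ListColouring-resp eqA eqB (colouring cA cB cA∈ cB∈ proper) =
    colouring cA cB (λ a → subst (cA a ∈_) (eqA a) (cA∈ a)) (λ b → subst (cB b ∈_) (eqB b) (cB∈ b)) proper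

  ListColouring-∘ˡ : {p′ : ℕ} (f : Fin p′ → Fin p) → ListColouring LA LB → ListColouring (LA ∘ f) LB
  ListColouring-∘ˡ f (colouring cA cB cA∈ cB∈ proper) = colouring (cA ∘ f) cB (cA∈ ∘ f) cB∈ (proper ∘ f)

  ListColouring-++⊥⁻ : ListColouring (λ a → LA a ++ ⊥ {r}) (λ b → LB b ++ ⊥ {r}) → ListColouring LA LB
  ListColouring-++⊥⁻ {r} (colouring cA cB cA∈ cB∈ proper) =
    colouring (proj₁ ∘ restrictA) (proj₁ ∘ restrictB) (proj₂ ∘ proj₂ ∘ restrictA) (proj₂ ∘ proj₂ ∘ restrictB)
      λ a b eq → proper a b
        (trans (proj₁ (proj₂ (restrictA a))) (trans (cong (_↑ˡ r) eq) (sym (proj₁ (proj₂ (restrictB b))))))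
    where
      restrictA : ∀ a → ∃ λ y → cA a ≡ y ↑ˡ r × y ∈ LA a
      restrictA a = x∈p++⊥⁻ (LA a) (cA∈ a)
      restrictB : ∀ b → ∃ λ y → cB b ≡ y ↑ˡ r × y ∈ LB b
      restrictB b = x∈p++⊥⁻ (LB b) (cB∈ b)

module _ {m : ℕ} {LA : Fin p → Subset (suc m)} {LB : Fin q → Subset (suc m)} where

  ListColouring-removeAt⁻ : (c : Fin (suc m)) →
    ListColouring (λ a → removeAt (LA a) c) (λ b → removeAt (LB b) c) → ListColouring LA LB
  ListColouring-removeAt⁻ c (colouring cA cB cA∈ cB∈ proper) =
    colouring (punchIn c ∘ cA) (punchIn c ∘ cB)
      (λ a → x∈removeAt⁻ (LA a) c (cA∈ a)) (λ b → x∈removeAt⁻ (LB b) c (cB∈ b))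
      λ a b → proper a b ∘ punchIn-injective c _ _

EveryIndependentSetMisses : (E : Fin p → Subset m) (F : Fin q → Subset m) → Set
EveryIndependentSetMisses E F = ∀ I → Independent E I → ∃ λ j → Disjoint (F j) I

module _ {E : Fin p → Subset m} {F : Fin q → Subset m} where

  separator⇒colouring : {I : Subset m} → Independent E I → (∀ j → ¬ Disjoint (F j) I) → ListColouring E F
  separator⇒colouring {I} independent meets =
    colouring (proj₁ ∘ leaves) (proj₁ ∘ enters) (proj₁ ∘ proj₂ ∘ leaves) (proj₁ ∘ proj₂ ∘ enters)
      λ a j eq → proj₂ (proj₂ (leaves a)) (subst (_∈ I) (sym eq) (proj₂ (proj₂ (enters j))))
    where
      leaves : ∀ a → ∃ λ x → x ∈ E a × x ∉ I
      leaves a = ⊈⇒∃∉ (independent a)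
      enters : ∀ j → ∃ λ x → x ∈ F j × x ∈ I
      enters j = ¬Disjoint⇒∃∈ (meets j)

  -- The colours used on B form the separator.
  colouring⇒separator : ListColouring E F → ∃ λ I → Independent E I × ∀ j → ¬ Disjoint (F j) I
  colouring⇒separator (colouring cA cB cA∈ cB∈ proper) =
    image , independent , λ j disjoint → disjoint (cB j) (cB∈ j) (cB∈image j)
    where
      image : Subset m
      image = ⋃ (List.tabulate (⁅_⁆ ∘ cB))
      cB∈image : ∀ j → cB j ∈ image
      cB∈image j = ⊆-⋃-tabulate (⁅_⁆ ∘ cB) j (x∈⁅x⁆ (cB j))
      independent : Independent E image
      independent a E⊆image with ∈-⋃-tabulate⁻ (⁅_⁆ ∘ cB) (E⊆image (cA∈ a))
      ... | j , cA∈⁅cB⁆ = proper a j (x∈⁅y⁆⇒x≡y (cB j) cA∈⁅cB⁆)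

  listColouring? : Dec (ListColouring E F)
  listColouring? =
    map′ (λ (_ , independent , meets) → separator⇒colouring independent meets) colouring⇒separator
      (anySubset? λ I → all? (λ i → ¬? (E i ⊆? I)) ×-dec all? (λ j → ¬? (disjoint? (F j) I)))

  ¬colouring⇔everyIndependentSetMisses : (¬ ListColouring E F) ⇔ EveryIndependentSetMisses E F
  ¬colouring⇔everyIndependentSetMisses = mk⇔
    (λ ¬colouring I independent → Product.map₂ (decidable-stable (disjoint? _ I))
      (¬∀⟶∃¬ _ _ (λ j → ¬? (disjoint? (F j) I)) (¬colouring ∘ separator⇒colouring independent)))
    λ misses colouring →
      let I , independent , meets = colouring⇒separator colouring
          j , disjoint = misses I independent
      in meets j disjoint

ChoosableIn : (m p q kA kB : ℕ) → Set
ChoosableIn m p q kA kB = (LA : Fin p → Subset m) (LB : Fin q → Subset m) →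
  (∀ a → ∣ LA a ∣ ≡ kA) → (∀ b → ∣ LB b ∣ ≡ kB) → ListColouring LA LB

choosable⇔choosableIn : Choosable (completeBip p q) kA kB ⇔ (∀ m → ChoosableIn m p q kA kB)
choosable⇔choosableIn {p} {q} {kA} {kB} = mk⇔ to from
  where
    to : Choosable (completeBip p q) kA kB → ∀ m → ChoosableIn m p q kA kB
    to choosable m LA LB ∣LA∣ ∣LB∣ with choosable m LA LB ∣LA∣ ∣LB∣
    ... | cA , cB , cA∈ , cB∈ , proper = colouring cA cB cA∈ cB∈ λ a b → proper a b _
    from : (∀ m → ChoosableIn m p q kA kB) → Choosable (completeBip p q) kA kB
    from choosable m LA LB ∣LA∣ ∣LB∣ with choosable m LA LB ∣LA∣ ∣LB∣
    ... | colouring cA cB cA∈ cB∈ proper = cA , cB , cA∈ , cB∈ , λ a b _ → proper a b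

choosableIn-+ʳ : ChoosableIn (m + r) p q kA kB → ChoosableIn m p q kA kB
choosableIn-+ʳ choosable LA LB ∣LA∣ ∣LB∣ = ListColouring-++⊥⁻
  (choosable (λ a → LA a ++ ⊥) (λ b → LB b ++ ⊥)
    (λ a → trans (∣p++⊥∣≡∣p∣ (LA a)) (∣LA∣ a)) (λ b → trans (∣p++⊥∣≡∣p∣ (LB b)) (∣LB∣ b)))

-- At most p kA + q kB colours occur in the lists, so one of the suc m colours can be deleted.
choosableIn-suc : p * kA + q * kB ≤ m → ChoosableIn m p q kA kB → ChoosableIn (suc m) p q kA kB
choosableIn-suc {p} {kA} {q} {kB} {m} enough choosable LA LB ∣LA∣ ∣LB∣ =
  ListColouring-removeAt⁻ c (choosable (λ a → removeAt (LA a) c) (λ b → removeAt (LB b) c)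
    (λ a → trans (∣removeAt∣≡ (LA a) (c∉used ∘ x∈p∪q⁺ ∘ inj₁ ∘ ⊆-⋃-tabulate LA a)) (∣LA∣ a))
    (λ b → trans (∣removeAt∣≡ (LB b) (c∉used ∘ x∈p∪q⁺ ∘ inj₂ ∘ ⊆-⋃-tabulate LB b)) (∣LB∣ b)))
  where
    used : Subset (suc m)
    used = ⋃ (List.tabulate LA) ∪ ⋃ (List.tabulate LB)
    ∣used∣≤m : ∣ used ∣ ≤ m
    ∣used∣≤m = ≤-trans (∣p∪q∣≤∣p∣+∣q∣ (⋃ (List.tabulate LA)) (⋃ (List.tabulate LB)))
      (≤-trans (+-mono-≤ (∣⋃-tabulate∣≤ LA (≤-reflexive ∘ ∣LA∣)) (∣⋃-tabulate∣≤ LB (≤-reflexive ∘ ∣LB∣))) enough)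
    c : Fin (suc m)
    c = proj₁ (∣p∣<n⇒∃∉ used (s≤s ∣used∣≤m))
    c∉used : c ∉ used
    c∉used = proj₂ (∣p∣<n⇒∃∉ used (s≤s ∣used∣≤m))

choosableIn-+ˡ : ChoosableIn (p * kA + q * kB) p q kA kB →
  ∀ r → ChoosableIn (r + (p * kA + q * kB)) p q kA kB
choosableIn-+ˡ choosable zero = choosable
choosableIn-+ˡ {p} {kA} {q} {kB} choosable (suc r) =
  choosableIn-suc (m≤n+m (p * kA + q * kB) r) (choosableIn-+ˡ choosable r)

choosableIn-all : ChoosableIn (p * kA + q * kB) p q kA kB → ∀ m → ChoosableIn m p q kA kB
choosableIn-all {p} {kA} {q} {kB} choosable m with ≤-total m (p * kA + q * kB)
... | inj₁ m≤N = let r , m+r≡N = m≤n⇒∃[o]m+o≡n m≤N in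
  choosableIn-+ʳ (subst (λ n → ChoosableIn n p q kA kB) (sym m+r≡N) choosable)
... | inj₂ N≤m = let r , N+r≡m = m≤n⇒∃[o]m+o≡n N≤m in
  subst (λ n → ChoosableIn n p q kA kB) (trans (+-comm r _) N+r≡m) (choosableIn-+ˡ choosable r)

Searchable : Set → Set₁
Searchable A = ∀ {P : Pred A 0ℓ} → Decidable P → Dec (∃ P)

search-Fin→ : {A : Set} → Searchable A → {P : Pred (Fin n → A) 0ℓ} → P Respects _≗_ → Decidable P → Dec (∃ P)
search-Fin→ {n = zero} _ resp P? = map′ (empty ,_) (λ (f , Pf) → resp (λ ()) Pf) (P? empty)
  where
    empty : Fin 0 → _
    empty ()
search-Fin→ {n = suc n} search resp P? =
  map′ (λ (x , g , Px◃g) → x ◃ g , Px◃g) (λ (f , Pf) → f zero , f ∘ suc , resp head◃tail Pf)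
    (search λ x → search-Fin→ search (λ g≗h → resp (◃-cong x g≗h)) (P? ∘ (x ◃_)))
  where
    head◃tail : ∀ {f : Fin (suc n) → _} → f ≗ f zero ◃ f ∘ suc
    head◃tail zero = refl
    head◃tail (suc i) = refl
    ◃-cong : ∀ x {g h : Fin n → _} → g ≗ h → x ◃ g ≗ x ◃ h
    ◃-cong x g≗h zero = refl
    ◃-cong x g≗h (suc i) = g≗h i

record UncolourableAssignment (p q kA kB : ℕ) : Set where
  field
    colours : ℕ
    listA : Fin p → Subset colours
    listB : Fin q → Subset colours
    ∣listA∣ : ∀ a → ∣ listA a ∣ ≡ kA
    ∣listB∣ : ∀ b → ∣ listB b ∣ ≡ kB
    uncolourable : ¬ ListColouring listA listB

open UncolourableAssignment

swap : UncolourableAssignment p q kA kB → UncolourableAssignment q p kB kA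
swap O = record
  { colours = colours O ; listA = listB O ; listB = listA O
  ; ∣listA∣ = ∣listB∣ O ; ∣listB∣ = ∣listA∣ O ; uncolourable = uncolourable O ∘ ListColouring-swap }

module _ {m p q kA kB : ℕ} where

  private
    Bad : (Fin p → Subset m) → (Fin q → Subset m) → Set
    Bad LA LB = (∀ a → ∣ LA a ∣ ≡ kA) × (∀ b → ∣ LB b ∣ ≡ kB) × ¬ ListColouring LA LB

    Bad-resp : {LA LA′ : Fin p → Subset m} {LB LB′ : Fin q → Subset m} →
      LA ≗ LA′ → LB ≗ LB′ → Bad LA LB → Bad LA′ LB′
    Bad-resp eqA eqB (∣LA∣ , ∣LB∣ , ¬colouring) =
      (λ a → trans (cong ∣_∣ (sym (eqA a))) (∣LA∣ a)) , (λ b → trans (cong ∣_∣ (sym (eqB b))) (∣LB∣ b)) ,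
      ¬colouring ∘ ListColouring-resp (sym ∘ eqA) (sym ∘ eqB)

    bad? : ∀ LA LB → Dec (Bad LA LB)
    bad? LA LB = all? (λ a → ∣ LA a ∣ ≟ℕ kA) ×-dec all? (λ b → ∣ LB b ∣ ≟ℕ kB) ×-dec ¬? listColouring?

    badAssignment? : Dec (∃ λ LA → ∃ (Bad LA))
    badAssignment? = search-Fin→ anySubset? (λ eqA (LB , bad) → LB , Bad-resp eqA (λ _ → refl) bad)
      λ LA → search-Fin→ anySubset? (Bad-resp (λ _ → refl)) (bad? LA)

  ¬choosableIn⇒uncolourable : ¬ ChoosableIn m p q kA kB → UncolourableAssignment p q kA kB
  ¬choosableIn⇒uncolourable ¬choosable with badAssignment?
  ... | yes (LA , LB , ∣LA∣ , ∣LB∣ , ¬colouring) =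
    record { colours = m ; listA = LA ; listB = LB ; ∣listA∣ = ∣LA∣ ; ∣listB∣ = ∣LB∣ ; uncolourable = ¬colouring }
  ... | no ∄ = contradiction
    (λ LA LB ∣LA∣ ∣LB∣ → decidable-stable listColouring? λ ¬colouring → ∄ (LA , LB , ∣LA∣ , ∣LB∣ , ¬colouring))
    ¬choosable

module Representative {X : Set} (_≟_ : DecidableEquality X) (L : Fin n → X) where

  firstIndex : (x : X) → ∃ (λ i → L i ≡ x) → ∃ λ i → L i ≡ x
  firstIndex x occurs with any? (λ i → L i ≟ x)
  ... | yes found = found
  ... | no ∄ = contradiction occurs ∄

  firstIndex-cong : ∀ {x y} → x ≡ y → (e : ∃ λ i → L i ≡ x) (e′ : ∃ λ i → L i ≡ y) →
    proj₁ (firstIndex x e) ≡ proj₁ (firstIndex y e′)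
  firstIndex-cong {x} refl e e′ with any? (λ i → L i ≟ x)
  ... | yes _ = refl
  ... | no ∄ = contradiction e ∄

  rep : Fin n → Fin n
  rep a = proj₁ (firstIndex (L a) (a , refl))

  L∘rep : ∀ a → L (rep a) ≡ L a
  L∘rep a = proj₂ (firstIndex (L a) (a , refl))

  rep-cong : ∀ {a b} → L a ≡ L b → rep a ≡ rep b
  rep-cong eq = firstIndex-cong eq _ _

  rep-idem : ∀ a → rep (rep a) ≡ rep a
  rep-idem a = rep-cong (L∘rep a)

-- Every A-list that is not the first occurrence of its value becomes a block of fresh colours.
module DistinctA (O : UncolourableAssignment p q (suc k) kB) where

  private
    c : ℕ
    c = colours O
    LA : Fin p → Subset c
    LA = listA O
    LB : Fin q → Subset c
    LB = listB O

  open Representative (≡-dec _≟ᵇ_) LA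

  fresh : Fin p → Subset (c + (p + k))
  fresh a = ⊥ {n = c} ++ (⁅ a ⁆ ++ ⊤ {n = k})

  ∣fresh∣ : ∀ a → ∣ fresh a ∣ ≡ suc k
  ∣fresh∣ a = begin
    ∣ fresh a ∣                             ≡⟨ ∣p++q∣≡∣p∣+∣q∣ (⊥ {n = c}) (⁅ a ⁆ ++ ⊤) ⟩
    ∣ ⊥ {n = c} ∣ + ∣ ⁅ a ⁆ ++ ⊤ {n = k} ∣  ≡⟨ cong₂ _+_ (∣⊥∣≡0 c) (∣p++q∣≡∣p∣+∣q∣ ⁅ a ⁆ ⊤) ⟩
    ∣ ⁅ a ⁆ ∣ + ∣ ⊤ {n = k} ∣               ≡⟨ cong₂ _+_ (∣⁅x⁆∣≡1 a) (∣⊤∣≡n k) ⟩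
    suc k                                   ∎
    where open ≡-Reasoning

  fresh-injective : Injective _≡_ _≡_ fresh
  fresh-injective {a} {b} eq =
    x∈⁅y⁆⇒x≡y b (subst (a ∈_) (++-injectiveˡ ⁅ a ⁆ ⁅ b ⁆ (++-injectiveʳ (⊥ {n = c}) ⊥ eq)) (x∈⁅x⁆ a))

  fresh≢++⊥ : ∀ a (s : Subset c) → fresh a ≢ s ++ ⊥
  fresh≢++⊥ a s eq = ∉⊥ (subst (a ↑ˡ k ∈_) (++-injectiveʳ (⊥ {n = c}) s eq) (x∈p⇒x↑ˡ∈p++q (⊤ {n = k}) (x∈⁅x⁆ a)))

  LA′ : Fin p → Subset (c + (p + k))
  LA′ a with rep a ≟ᶠ a
  ... | yes _ = LA a ++ ⊥
  ... | no _ = fresh a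

  LB′ : Fin q → Subset (c + (p + k))
  LB′ b = LB b ++ ⊥

  ∣LA′∣ : ∀ a → ∣ LA′ a ∣ ≡ suc k
  ∣LA′∣ a with rep a ≟ᶠ a
  ... | yes _ = trans (∣p++⊥∣≡∣p∣ (LA a)) (∣listA∣ O a)
  ... | no _ = ∣fresh∣ a

  LA′∘rep : ∀ a → LA′ (rep a) ≡ LA (rep a) ++ ⊥
  LA′∘rep a with rep (rep a) ≟ᶠ rep a
  ... | yes _ = refl
  ... | no rep≢ = contradiction (rep-idem a) rep≢

  LA′-injective : Injective _≡_ _≡_ LA′
  LA′-injective {a} {b} eq with rep a ≟ᶠ a | rep b ≟ᶠ b
  ... | yes rep≡a | yes rep≡b = trans (sym rep≡a) (trans (rep-cong (++-injectiveˡ (LA a) (LA b) eq)) rep≡b)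
  ... | yes _ | no _ = contradiction (sym eq) (fresh≢++⊥ b (LA a))
  ... | no _ | yes _ = contradiction eq (fresh≢++⊥ a (LA b))
  ... | no _ | no _ = fresh-injective eq

  -- Vertices with equal A-lists take the colour of their representative.
  uncolourable′ : ¬ ListColouring LA′ LB′
  uncolourable′ = uncolourable O ∘ ListColouring-resp L∘rep (λ _ → refl) ∘ ListColouring-++⊥⁻
    ∘ ListColouring-resp LA′∘rep (λ _ → refl) ∘ ListColouring-∘ˡ rep

distinctA : (O : UncolourableAssignment p q (suc k) kB) →
  Σ[ O′ ∈ UncolourableAssignment p q (suc k) kB ]
    Injective _≡_ _≡_ (listA O′) × (Injective _≡_ _≡_ (listB O) → Injective _≡_ _≡_ (listB O′))
distinctA O =
  record
    { colours = _ ; listA = LA′ ; listB = LB′ ; ∣listA∣ = ∣LA′∣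
    ; ∣listB∣ = λ b → trans (∣p++⊥∣≡∣p∣ (listB O b)) (∣listB∣ O b) ; uncolourable = uncolourable′ } ,
  LA′-injective , λ injective eq → injective (++-injectiveˡ _ _ eq)
  where open DistinctA O

distinct : UncolourableAssignment p q (suc kA) (suc kB) →
  Σ[ O ∈ UncolourableAssignment p q (suc kA) (suc kB) ] Injective _≡_ _≡_ (listA O) × Injective _≡_ _≡_ (listB O)
distinct O =
  let O₁ , injectiveA₁ , _ = distinctA O
      O₂ , injectiveB₂ , preserves = distinctA (swap O₁)
  in swap O₂ , preserves injectiveA₁ , injectiveB₂

lemma1p7 : (kA kB ΔA ΔB : ℕ) → kA ≥ 1 → kB ≥ 1 → ΔA ≥ 1 → ΔB ≥ 1 →
    (¬ Choosable (completeBip ΔB ΔA) kA kB) ⇔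
    (Σ ℕ λ n → Σ (Fin ΔB → Subset n) λ E → Σ (Fin ΔA → Subset n) λ F →
    UniformWithEdges kA ΔB E ×
    Injective _≡_ _≡_ F × (∀ j → ∣ F j ∣ ≡ kB) ×
    (∀ (I : Subset n) → Independent E I → ∃ λ j → Disjoint (F j) I))
lemma1p7 _ _ _ _ (s≤s z≤n) (s≤s z≤n) _ _ = mk⇔
  (λ ¬choosable →
    let ¬choosableIn = ¬choosable ∘ Equivalence.from choosable⇔choosableIn ∘ choosableIn-all
        O , injectiveE , injectiveF = distinct (¬choosableIn⇒uncolourable ¬choosableIn)
    in colours O , listA O , listB O , ((λ {a b} → injectiveE) , ∣listA∣ O) , (λ {a b} → injectiveF) ,
       ∣listB∣ O , Equivalence.to ¬colouring⇔everyIndependentSetMisses (uncolourable O))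
  λ (n , E , F , (_ , ∣E∣) , _ , ∣F∣ , misses) choosable →
    Equivalence.from ¬colouring⇔everyIndependentSetMisses misses
      (Equivalence.to choosable⇔choosableIn choosable n E F ∣E∣ ∣F∣)
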